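{- Let $\mathbf{a}$ be a weak composition and $\alpha=\flat(\mathbf{a})$. For every diagram $D$ with $R_\alpha(D)\neq0$, the diagram $R_\alpha(D)$ has the same weight as $D$; and $R_\alpha$ is injective on the set of diagrams $D$ with $R_\alpha(D)\ne0$.
   Context: A weak composition is a finite sequence $\mathbf{a}=(a_1,\ldots,a_n)$ of nonnegative integers; $\flat(\mathbf{a})=(\alpha_1,\ldots,\alpha_\ell)$ is the sequence of its nonzero parts in order. A diagram is a finite set of cells $(c,r)$ with $c,r$ positive integers ($c$ column, $r$ row); its weight is the weak composition whose $r$-th part is the number of cells in row $r$. Rectification operators: for a diagram $D$, a column index $c\ge1$ and row $r$, let $M^c(D,r)$ be the number of cells of $D$ in column $c+1$ with row $\ge r$ minus the number of cells in column $c$ with row $\ge r$, and $M^c(D)=\max_r M^c(D,r)$. If $M^c(D)\le0$ set $\tilde e_c(D)=0$; otherwise, with $r$ the largest row index such that $M^c(D,r)=M^c(D)$, $\tilde e_c(D)$ is obtained by moving the cell at column $c+1$, row $r$ to column $c$, row $r$. Also $\tilde e_c(0)=0$. With $m=\max_i a_i$, define $R_{\alpha,i}=(\tilde e_{\alpha_i}\circ\cdots\circ\tilde e_{m-1})\circ\cdots\circ(\tilde e_2\circ\cdots\circ\tilde e_{m-\alpha_i+1})\circ(\tilde e_1\circ\cdots\circ\tilde e_{m-\alpha_i})$, i.e. the composition for $j=1,\ldots,\alpha_i$ (with $j=1$ applied first) of the blocks $\tilde e_j\circ\tilde e_{j+1}\circ\cdots\circ\tilde e_{m-\alpha_i+j-1}$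 (empty block if $m=\alpha_i$), and $R_\alpha=R_{\alpha,\ell}\circ\cdots\circ R_{\alpha,1}$. -}

module Defs where

open import Data.Nat as ℕ using (ℕ; zero; suc; _≤_; _≡ᵇ_; _≤ᵇ_; _⊔_)
open import Data.Integer as ℤ using (ℤ; +_; _-_)
open import Data.Bool using (Bool; true; false; if_then_else_; _∧_; not)
open import Data.Product using (_×_; _,_; proj₁; proj₂)
open import Data.List using (List; []; _∷_; map; foldr; foldl; length; filterᵇ; upTo)
open import Data.Maybe using (Maybe; just; nothing; _>>=_)
open import Data.List.Relation.Unary.All using (All)
open import Data.List.Relation.Unary.Unique.Propositional using (Unique)
open import Data.List.Membership.Propositional using (_∈_)
open import Function.Bundles using (_⇔_)

-- A cell (c , r): c = column, r = row (both positive in a diagram).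
Cell : Set
Cell = ℕ × ℕ

-- A diagram is a finite set of cells, represented by a duplicate-free list
-- of cells with positive coordinates.  The value 0 of the rectification
-- operators is represented by 'nothing'.
RawDiagram : Set
RawDiagram = List Cell

IsDiagram : RawDiagram → Set
IsDiagram D = Unique D × All (λ x → (1 ≤ proj₁ x) × (1 ≤ proj₂ x)) D

SameCells : RawDiagram → RawDiagram → Set
SameCells D E = (x : Cell) → (x ∈ D) ⇔ (x ∈ E)

countᵇ : (Cell → Bool) → RawDiagram → ℕ
countᵇ p D = length (filterᵇ p D)

weight : RawDiagram → ℕ → ℕ
weight D r = countᵇ (λ x → proj₂ x ≡ᵇ r) D

colGE : RawDiagram → ℕ → ℕ → ℕ
colGE D c r = countᵇ (λ x → (proj₁ x ≡ᵇ c) ∧ (r ≤ᵇ proj₂ x)) D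

Mc : ℕ → RawDiagram → ℕ → ℤ
Mc c D r = + colGE D (suc c) r - + colGE D c r

maxRow : RawDiagram → ℕ
maxRow D = foldr (λ x m → proj₂ x ⊔ m) 0 D

-- rows 1 .. maxRow D + 1 ; for rows beyond maxRow D, M^c(D,r) = 0,
-- so maximising over this range equals maximising over all rows r ≥ 1.
rows : RawDiagram → List ℕ
rows D = map suc (upTo (suc (maxRow D)))

-- M^c(D) = max_r M^c(D,r)  (0 is attained at row maxRow D + 1)
McMax : ℕ → RawDiagram → ℤ
McMax c D = foldr (λ r m → Mc c D r ℤ.⊔ m) (+ 0) (rows D)

argMaxRow : ℕ → RawDiagram → ℕ
argMaxRow c D =
  foldl (λ acc r → if (Mc c D r ℤ.≤ᵇ McMax c D) ∧ (McMax c D ℤ.≤ᵇ Mc c D r) then r else acc)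
        0 (rows D)

moveCell : ℕ → ℕ → Cell → Cell
moveCell c r x =
  if (proj₁ x ≡ᵇ suc c) ∧ (proj₂ x ≡ᵇ r) then (c , r) else x

eTilde : ℕ → RawDiagram → Maybe RawDiagram
eTilde c D =
  if McMax c D ℤ.≤ᵇ + 0 then nothing
  else just (map (moveCell c (argMaxRow c D)) D)

eM : ℕ → Maybe RawDiagram → Maybe RawDiagram
eM c x = x >>= eTilde c

applyDown : ℕ → ℕ → Maybe RawDiagram → Maybe RawDiagram
applyDown j zero    x = x
applyDown j (suc k) x = eM j (applyDown (suc j) k x)

blocks : ℕ → ℕ → ℕ → Maybe RawDiagram → Maybe RawDiagram
blocks k j zero    x = x
blocks k j (suc n) x = blocks k (suc j) n (applyDown j k x)

Rαi : ℕ → ℕ → Maybe RawDiagram → Maybe RawDiagram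
Rαi m αi = blocks (m ℕ.∸ αi) 1 αi

maxPart : List ℕ → ℕ
maxPart = foldr _⊔_ 0

flat : List ℕ → List ℕ
flat = filterᵇ (λ x → not (x ≡ᵇ 0))

-- R_α = R_{α,ℓ} ∘ ⋯ ∘ R_{α,1}  (R_{α,1} applied first), m = max_i a_i
Rα : List ℕ → RawDiagram → Maybe RawDiagram
Rα a D = foldl (λ x αi → Rαi (maxPart a) αi x) (just D) (flat a)

module Submission where

-- R_α is a composite of the operators ẽ_c (extended by ẽ_c(0) = 0), so it
-- suffices to prove the two properties for a single ẽ_c and to observe that
-- they are stable under composition ('Admissible' operators, last section).
--
-- For one step D ↦ D' = ẽ_c(D) ≠ 0 let r be its row: the last row at which
-- M^c(D, ·) attains its positive maximum ('LastPeak').  Comparing rows r and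
-- r+1 shows that D has the cell (c+1, r) but not (c, r), so ẽ_c moves exactly
-- one cell within its row: weight and duplicate-freeness are preserved.
-- After the move, r+1 is the FIRST row at which M^c(D', ·) is maximal
-- ('FirstPeak').  Since M^c(D', ·) only depends on the cells of D', the row r
-- is determined by D', and D is recovered from D' and r by moving (c, r) back.

open import Defs
open import Data.Nat as ℕ using (ℕ; zero; suc; _+_; _≤_; _<_; z≤n; s≤s; _≡ᵇ_; _≤ᵇ_)
import Data.Nat.Properties as ℕP
open import Data.Nat.Tactic.RingSolver using (solve-∀)
open import Data.Integer as ℤ using (ℤ)
import Data.Integer.Properties as ℤP
import Data.Integer.Tactic.RingSolver as ℤSolver
open import Data.Bool using (Bool; true; false; if_then_else_; _∧_; T)
open import Data.Bool.Properties using (T-≡; ∧-zeroʳ)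
open import Data.Product using (_×_; _,_; proj₁; proj₂; ∃-syntax)
open import Data.Product.Properties using (≡-dec)
open import Data.Sum using (_⊎_; inj₁; inj₂)
open import Data.List using (List; []; _∷_; map; _++_; foldr; foldl; upTo)
import Data.List.Properties as ListP
import Data.List.Relation.Unary.All as All
open import Data.List.Relation.Unary.AllPairs using (_∷_; [])
open import Data.List.Relation.Unary.Any using (here; there)
open import Data.List.Relation.Unary.Unique.Propositional using (Unique)
open import Data.List.Membership.Propositional using (_∈_; _∉_)
open import Data.List.Membership.Propositional.Properties using (∈-map⁻; ∈-map⁺)
open import Data.List.Membership.Propositional.Properties.WithK using (unique∧set⇒bag)
open import Data.List.Relation.Binary.BagAndSetEquality using (∼bag⇒↭)
open import Data.List.Relation.Binary.Permutation.Propositional.Properties using (filter-↭; ↭-length)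
open import Data.Maybe using (Maybe; just; nothing)
open import Data.Maybe.Properties using (just-injective)
open import Data.Empty using (⊥-elim)
open import Relation.Nullary using (¬_; yes; no; Dec)
open import Relation.Binary.Definitions using (Tri)
open import Relation.Binary.PropositionalEquality
open import Function.Bundles using (_⇔_; mk⇔; Equivalence)
open import Function.Properties.Equivalence using () renaming (refl to ⇔-refl; sym to ⇔-sym; trans to ⇔-trans)
open import Data.Sum.Function.Propositional using (_⊎-⇔_)
open import Data.Product.Function.NonDependent.Propositional using (_×-⇔_)

true≢false : true ≢ false
true≢false ()

false-if-¬T : ∀ b → ¬ T b → b ≡ false
false-if-¬T true  ¬t = ⊥-elim (¬t _)
false-if-¬T false _  = refl

≡ᵇ-true : ∀ m n → m ≡ n → (m ≡ᵇ n) ≡ true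
≡ᵇ-true m n e = Equivalence.to T-≡ (ℕP.≡⇒≡ᵇ m n e)

≡ᵇ-false : ∀ m n → m ≢ n → (m ≡ᵇ n) ≡ false
≡ᵇ-false m n m≢n = false-if-¬T _ (λ t → m≢n (ℕP.≡ᵇ⇒≡ m n t))

≡ᵇ-sound : ∀ m n → (m ≡ᵇ n) ≡ true → m ≡ n
≡ᵇ-sound m n e = ℕP.≡ᵇ⇒≡ m n (Equivalence.from T-≡ e)

≤ᵇ-true : ∀ m n → m ≤ n → (m ≤ᵇ n) ≡ true
≤ᵇ-true m n m≤n = Equivalence.to T-≡ (ℕP.≤⇒≤ᵇ m≤n)

≤ᵇ-false : ∀ m n → n < m → (m ≤ᵇ n) ≡ false
≤ᵇ-false m n n<m = false-if-¬T _ (λ t → ℕP.<⇒≱ n<m (ℕP.≤ᵇ⇒≤ m n t))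

∧-true : ∀ a b → (a ∧ b) ≡ true → (a ≡ true) × (b ≡ true)
∧-true true b e = refl , e

-- Counting the cells of a list that pass a test.  'count' is 'countᵇ'
-- written as a sum of indicators, which unfolds one cell at a time.

𝟙 : Bool → ℕ
𝟙 true  = 1
𝟙 false = 0

count : (Cell → Bool) → RawDiagram → ℕ
count p []      = 0
count p (x ∷ D) = 𝟙 (p x) + count p D

countᵇ≡count : ∀ p D → countᵇ p D ≡ count p D
countᵇ≡count p [] = refl
countᵇ≡count p (x ∷ D) with p x
... | true  = cong suc (countᵇ≡count p D)
... | false = countᵇ≡count p D

count-map : ∀ p (f : Cell → Cell) D → count p (map f D) ≡ count (λ x → p (f x)) D
count-map p f []      = refl
count-map p f (x ∷ D) = cong (𝟙 (p (f x)) +_) (count-map p f D)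

count-cong : ∀ p q D → (∀ x → x ∈ D → p x ≡ q x) → count p D ≡ count q D
count-cong p q []      h = refl
count-cong p q (x ∷ D) h =
  cong₂ _+_ (cong 𝟙 (h x (here refl))) (count-cong p q D (λ y y∈D → h y (there y∈D)))

count-split : ∀ p q q′ D → (∀ x → 𝟙 (p x) ≡ 𝟙 (q x) + 𝟙 (q′ x)) →
              count p D ≡ count q D + count q′ D
count-split p q q′ []      h = refl
count-split p q q′ (x ∷ D) h
  rewrite h x | count-split p q q′ D h = interchange (𝟙 (q x)) (𝟙 (q′ x)) (count q D) (count q′ D)
  where
  interchange : ∀ a b c d → (a + b) + (c + d) ≡ (a + c) + (b + d)
  interchange = solve-∀

count-none : ∀ p D → (∀ x → x ∈ D → p x ≡ false) → count p D ≡ 0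
count-none p []      h = refl
count-none p (x ∷ D) h rewrite h x (here refl) = count-none p D (λ y y∈D → h y (there y∈D))

count-witness : ∀ p D → 1 ≤ count p D → ∃[ x ] (x ∈ D × p x ≡ true)
count-witness p (x ∷ D) pos with p x in px
... | true  = x , here refl , px
... | false with count-witness p D pos
...   | y , y∈D , py = y , there y∈D , py

count-member : ∀ p D y → y ∈ D → p y ≡ true → 1 ≤ count p D
count-member p (x ∷ D) y (here refl) py rewrite py = s≤s z≤n
count-member p (x ∷ D) y (there y∈D) py =
  ℕP.≤-trans (count-member p D y y∈D py) (ℕP.m≤n+m _ (𝟙 (p x)))

count-≤1 : ∀ p D y → Unique D → (∀ x → p x ≡ true → x ≡ y) → count p D ≤ 1
count-≤1 p []      y u h = z≤n
count-≤1 p (x ∷ D) y (x∉D ∷ u) h with p x in px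
... | false = count-≤1 p D y u h
... | true  = subst (λ k → 1 + k ≤ 1) (sym (count-none p D others-fail)) ℕP.≤-refl
  where
  others-fail : ∀ z → z ∈ D → p z ≡ false
  others-fail z z∈D with p z in pz
  ... | false = refl
  ... | true  = ⊥-elim (All.lookup x∉D z∈D (trans (h x px) (sym (h z pz))))

count-replace : ∀ p (f : Cell → Cell) D y → Unique D → y ∈ D → (∀ x → x ≢ y → f x ≡ x) →
                count p (map f D) + 𝟙 (p y) ≡ count p D + 𝟙 (p (f y))
count-replace p f (x ∷ D) .x (x∉D ∷ u) (here refl) fixes = begin
  (𝟙 (p (f x)) + count p (map f D)) + 𝟙 (p x) ≡⟨ cong (λ k → (𝟙 (p (f x)) + k) + 𝟙 (p x)) rest-unchanged ⟩
  (𝟙 (p (f x)) + count p D) + 𝟙 (p x)         ≡⟨ rearrange (𝟙 (p (f x))) (count p D) (𝟙 (p x)) ⟩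
  (𝟙 (p x) + count p D) + 𝟙 (p (f x))         ∎
  where
  open ≡-Reasoning
  rest-unchanged : count p (map f D) ≡ count p D
  rest-unchanged = trans (count-map p f D) (count-cong (λ z → p (f z)) p D
    (λ z z∈D → cong p (fixes z (λ z≡x → All.lookup x∉D z∈D (sym z≡x)))))
  rearrange : ∀ a b c → (a + b) + c ≡ (c + b) + a
  rearrange = solve-∀
count-replace p f (x ∷ D) y (x∉D ∷ u) (there y∈D) fixes
  rewrite fixes x (All.lookup x∉D y∈D)
        | ℕP.+-assoc (𝟙 (p x)) (count p (map f D)) (𝟙 (p y))
        | count-replace p f D y u y∈D fixes = sym (ℕP.+-assoc (𝟙 (p x)) (count p D) _)

unique-map : ∀ (f : Cell → Cell) D → Unique D →
             (∀ a b → a ∈ D → b ∈ D → f a ≡ f b → a ≡ b) → Unique (map f D)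
unique-map f []      u         inj = []
unique-map f (x ∷ D) (x∉D ∷ u) inj =
  All.tabulate fx∉fD ∷ unique-map f D u (λ a b a∈D b∈D → inj a b (there a∈D) (there b∈D))
  where
  fx∉fD : ∀ {z} → z ∈ map f D → f x ≢ z
  fx∉fD z∈fD e with ∈-map⁻ f z∈fD
  ... | w , w∈D , z≡fw = All.lookup x∉D w∈D (inj x w (here refl) (there w∈D) (trans e z≡fw))

-- Duplicate-free lists with the same cells are permutations of each other,
-- so every count agrees on them.
sameCells⇒sameCount : ∀ p D E → Unique D → Unique E → SameCells D E → countᵇ p D ≡ countᵇ p E
sameCells⇒sameCount p D E uD uE same =
  ↭-length (filter-↭ _ (∼bag⇒↭ (unique∧set⇒bag uD uE (λ {x} → same x))))

_≟ᶜ_ : (x y : Cell) → Dec (x ≡ y)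
_≟ᶜ_ = ≡-dec ℕP._≟_ ℕP._≟_

isCell : ℕ → ℕ → Cell → Bool
isCell k t x = (proj₁ x ≡ᵇ k) ∧ (proj₂ x ≡ᵇ t)

isCell-sound : ∀ k t x → isCell k t x ≡ true → x ≡ (k , t)
isCell-sound k t (a , b) e with ∧-true (a ≡ᵇ k) (b ≡ᵇ t) e
... | a≡k , b≡t = cong₂ _,_ (≡ᵇ-sound a k a≡k) (≡ᵇ-sound b t b≡t)

isCell-refl : ∀ k t → isCell k t (k , t) ≡ true
isCell-refl k t rewrite ≡ᵇ-true k k refl | ≡ᵇ-true t t refl = refl

inColumnFrom : ℕ → ℕ → Cell → Bool
inColumnFrom k t x = (proj₁ x ≡ᵇ k) ∧ (t ≤ᵇ proj₂ x)

colGE≡count : ∀ D k t → colGE D k t ≡ count (inColumnFrom k t) D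
colGE≡count D k t = countᵇ≡count (inColumnFrom k t) D

colGE-split : ∀ D k t → colGE D k t ≡ count (isCell k t) D + colGE D k (suc t)
colGE-split D k t
  rewrite colGE≡count D k t | colGE≡count D k (suc t) =
  count-split (inColumnFrom k t) (isCell k t) (inColumnFrom k (suc t)) D cellwise
  where
  rowwise : ∀ b → 𝟙 (t ≤ᵇ b) ≡ 𝟙 (b ≡ᵇ t) + 𝟙 (suc t ≤ᵇ b)
  rowwise b with ℕP.<-cmp t b
  ... | Tri.tri< t<b _ _
    rewrite ≤ᵇ-true t b (ℕP.<⇒≤ t<b) | ≡ᵇ-false b t (ℕP.>⇒≢ t<b) | ≤ᵇ-true (suc t) b t<b = refl
  ... | Tri.tri≈ _ refl _
    rewrite ≤ᵇ-true t t ℕP.≤-refl | ≡ᵇ-true t t refl | ≤ᵇ-false (suc t) t (ℕP.n<1+n t) = refl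
  ... | Tri.tri> _ _ b<t
    rewrite ≤ᵇ-false t b b<t | ≡ᵇ-false b t (ℕP.<⇒≢ b<t)
          | ≤ᵇ-false (suc t) b (ℕP.m<n⇒m<1+n b<t) = refl
  cellwise : ∀ x → 𝟙 (inColumnFrom k t x) ≡ 𝟙 (isCell k t x) + 𝟙 (inColumnFrom k (suc t) x)
  cellwise (a , b) with a ≡ᵇ k
  ... | true  = rowwise b
  ... | false = refl

maxRow-bound : ∀ D x → x ∈ D → proj₂ x ≤ maxRow D
maxRow-bound (y ∷ D) x (here refl) = ℕP.m≤m⊔n (proj₂ x) (maxRow D)
maxRow-bound (y ∷ D) x (there x∈D) =
  ℕP.≤-trans (maxRow-bound D x x∈D) (ℕP.m≤n⊔m (proj₂ y) (maxRow D))

colGE-above-maxRow : ∀ D k t → maxRow D < t → colGE D k t ≡ 0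
colGE-above-maxRow D k t above rewrite colGE≡count D k t = count-none (inColumnFrom k t) D too-low
  where
  too-low : ∀ x → x ∈ D → inColumnFrom k t x ≡ false
  too-low x x∈D rewrite ≤ᵇ-false t (proj₂ x) (ℕP.≤-<-trans (maxRow-bound D x x∈D) above)
    = ∧-zeroʳ (proj₁ x ≡ᵇ k)

-- Clearing subtractions: M^c(D,t) = a - b with a, b natural, and comparing
-- two such differences amounts to a cross-wise comparison of sums in ℕ.

private
  add-back : ∀ a b d → (ℤ.+ a ℤ.- ℤ.+ b) ℤ.+ (ℤ.+ b ℤ.+ ℤ.+ d) ≡ ℤ.+ (a + d)
  add-back a b d = trans (cancel (ℤ.+ a) (ℤ.+ b) (ℤ.+ d)) (sym (ℤP.pos-+ a d))
    where
    cancel : ∀ (x y z : ℤ) → (x ℤ.- y) ℤ.+ (y ℤ.+ z) ≡ x ℤ.+ z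
    cancel = ℤSolver.solve-∀

  add-back′ : ∀ c d b → (ℤ.+ c ℤ.- ℤ.+ d) ℤ.+ (ℤ.+ b ℤ.+ ℤ.+ d) ≡ ℤ.+ (c + b)
  add-back′ c d b = trans (cong (ℤ._+_ (ℤ.+ c ℤ.- ℤ.+ d)) (ℤP.+-comm (ℤ.+ b) (ℤ.+ d))) (add-back c d b)

-- Add b + d to both sides.
diff-≤ : ∀ a b c d → (ℤ.+ a ℤ.- ℤ.+ b) ℤ.≤ (ℤ.+ c ℤ.- ℤ.+ d) → a + d ≤ c + b
diff-≤ a b c d ≤ =
  ℤP.drop‿+≤+ (subst₂ ℤ._≤_ (add-back a b d) (add-back′ c d b) (ℤP.+-monoˡ-≤ (ℤ.+ b ℤ.+ ℤ.+ d) ≤))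

diff-< : ∀ a b c d → (ℤ.+ a ℤ.- ℤ.+ b) ℤ.< (ℤ.+ c ℤ.- ℤ.+ d) → a + d < c + b
diff-< a b c d < =
  ℤP.drop‿+<+ (subst₂ ℤ._<_ (add-back a b d) (add-back′ c d b) (ℤP.+-monoˡ-< (ℤ.+ b ℤ.+ ℤ.+ d) <))

rowsUpTo : ℕ → List ℕ
rowsUpTo n = map suc (upTo n)

rowsUpTo-snoc : ∀ n → rowsUpTo (suc n) ≡ rowsUpTo n ++ (suc n ∷ [])
rowsUpTo-snoc n = trans (cong (map suc) (sym (ListP.upTo-∷ʳ n))) (ListP.map-++ suc (upTo n) (n ∷ []))

maxOver : (ℕ → ℤ) → ℤ → ℕ → ℤ
maxOver f b n = foldr (λ t m → f t ℤ.⊔ m) b (rowsUpTo n)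

maxOver-snoc : ∀ f b n → maxOver f b (suc n) ≡ maxOver f (f (suc n) ℤ.⊔ b) n
maxOver-snoc f b n = trans (cong (foldr (λ t m → f t ℤ.⊔ m) b) (rowsUpTo-snoc n))
                           (ListP.foldr-++ (λ t m → f t ℤ.⊔ m) b (rowsUpTo n) (suc n ∷ []))

maxOver-≥base : ∀ f b n → b ℤ.≤ maxOver f b n
maxOver-≥base f b zero = ℤP.≤-refl
maxOver-≥base f b (suc n) rewrite maxOver-snoc f b n =
  ℤP.≤-trans (ℤP.i≤j⊔i (f (suc n)) b) (maxOver-≥base f _ n)

maxOver-upper : ∀ f b n t → 1 ≤ t → t ≤ n → f t ℤ.≤ maxOver f b n
maxOver-upper f b zero t 1≤t t≤0 = ⊥-elim (ℕP.<⇒≱ 1≤t t≤0)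
maxOver-upper f b (suc n) t 1≤t t≤n+1 rewrite maxOver-snoc f b n with ℕP.m≤n⇒m<n∨m≡n t≤n+1
... | inj₁ t≤n  = maxOver-upper f _ n t 1≤t (ℕP.≤-pred t≤n)
... | inj₂ refl = ℤP.≤-trans (ℤP.i≤i⊔j (f (suc n)) b) (maxOver-≥base f _ n)

maxOver-attained : ∀ f b n → maxOver f b n ≡ b ⊎ ∃[ t ] (1 ≤ t × t ≤ n × maxOver f b n ≡ f t)
maxOver-attained f b zero = inj₁ refl
maxOver-attained f b (suc n) rewrite maxOver-snoc f b n with maxOver-attained f (f (suc n) ℤ.⊔ b) n
... | inj₂ (t , 1≤t , t≤n , e) = inj₂ (t , 1≤t , ℕP.m≤n⇒m≤1+n t≤n , e)
... | inj₁ e with ℤP.⊔-sel (f (suc n)) b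
...   | inj₁ e′ = inj₂ (suc n , s≤s z≤n , ℕP.≤-refl , trans e e′)
...   | inj₂ e′ = inj₁ (trans e e′)

lastWhere : (ℕ → Bool) → ℕ → ℕ
lastWhere P n = foldl (λ acc t → if P t then t else acc) 0 (rowsUpTo n)

lastWhere-snoc : ∀ P n → lastWhere P (suc n) ≡ (if P (suc n) then suc n else lastWhere P n)
lastWhere-snoc P n = trans (cong (foldl (λ acc t → if P t then t else acc) 0) (rowsUpTo-snoc n))
                           (ListP.foldl-++ (λ acc t → if P t then t else acc) 0 (rowsUpTo n) (suc n ∷ []))

lastWhere-found : ∀ P n t → 1 ≤ t → t ≤ n → P t ≡ true →
                  (1 ≤ lastWhere P n) × (lastWhere P n ≤ n) × (P (lastWhere P n) ≡ true)
lastWhere-found P zero t 1≤t t≤0 _ = ⊥-elim (ℕP.<⇒≱ 1≤t t≤0)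
lastWhere-found P (suc n) t 1≤t t≤n+1 Pt rewrite lastWhere-snoc P n with P (suc n) in Pn+1
... | true  = s≤s z≤n , ℕP.≤-refl , Pn+1
... | false with ℕP.m≤n⇒m<n∨m≡n t≤n+1
...   | inj₂ refl = ⊥-elim (true≢false (trans (sym Pt) Pn+1))
...   | inj₁ t≤n with lastWhere-found P n t 1≤t (ℕP.≤-pred t≤n) Pt
...     | 1≤l , l≤n , Pl = 1≤l , ℕP.m≤n⇒m≤1+n l≤n , Pl

lastWhere-last : ∀ P n t → lastWhere P n < t → t ≤ n → P t ≡ false
lastWhere-last P zero t l<t t≤0 = ⊥-elim (ℕP.<⇒≱ l<t t≤0)
lastWhere-last P (suc n) t l<t t≤n+1 rewrite lastWhere-snoc P n with P (suc n) in Pn+1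
... | true  = ⊥-elim (ℕP.<⇒≱ l<t t≤n+1)
... | false with ℕP.m≤n⇒m<n∨m≡n t≤n+1
...   | inj₂ refl = Pn+1
...   | inj₁ t≤n  = lastWhere-last P n t l<t (ℕP.≤-pred t≤n)

-- Peaks of M^c(D, ·).  'RowLE c D t p' says M^c(D,t) ≤ M^c(D,p), with the
-- subtractions cleared; 'RowLT' is the strict version.

RowLE : ℕ → RawDiagram → ℕ → ℕ → Set
RowLE c D t p = colGE D (suc c) t + colGE D c p ≤ colGE D (suc c) p + colGE D c t

RowLT : ℕ → RawDiagram → ℕ → ℕ → Set
RowLT c D t p = colGE D (suc c) t + colGE D c p < colGE D (suc c) p + colGE D c t

record LastPeak (c : ℕ) (D : RawDiagram) (r : ℕ) : Set where
  field
    maximal : ∀ t → 1 ≤ t → RowLE c D t r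
    last    : ∀ t → r < t → RowLT c D t r

record FirstPeak (c : ℕ) (D : RawDiagram) (p : ℕ) : Set where
  field
    maximal : ∀ t → 1 ≤ t → RowLE c D t p
    first   : ∀ t → 1 ≤ t → t < p → RowLT c D t p

-- Two first peaks coincide: the smaller one would be strictly below the
-- larger one, contradicting its maximality.
firstPeak-unique : ∀ {c D p q} → 1 ≤ p → 1 ≤ q → FirstPeak c D p → FirstPeak c D q → p ≡ q
firstPeak-unique {p = p} {q} 1≤p 1≤q peak-p peak-q with ℕP.<-cmp p q
... | Tri.tri< p<q _ _ =
  ⊥-elim (ℕP.<⇒≱ (FirstPeak.first peak-q p 1≤p p<q) (FirstPeak.maximal peak-p q 1≤q))
... | Tri.tri≈ _ p≡q _ = p≡q
... | Tri.tri> _ _ q<p =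
  ⊥-elim (ℕP.<⇒≱ (FirstPeak.first peak-p q 1≤q q<p) (FirstPeak.maximal peak-q p 1≤p))

SameColumns : RawDiagram → RawDiagram → Set
SameColumns D E = ∀ k t → colGE D k t ≡ colGE E k t

firstPeak-transport : ∀ {c D E p} → SameColumns D E → FirstPeak c D p → FirstPeak c E p
firstPeak-transport {c} {D} {E} {p} same peak = record
  { maximal = λ t 1≤t → subst₂ _≤_ (cross t p) (cross p t) (FirstPeak.maximal peak t 1≤t)
  ; first   = λ t 1≤t t<p → subst₂ _<_ (cross t p) (cross p t) (FirstPeak.first peak t 1≤t t<p)
  }
  where
  cross : ∀ t u → colGE D (suc c) t + colGE D c u ≡ colGE E (suc c) t + colGE E c u
  cross t u = cong₂ _+_ (same (suc c) t) (same c u)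

record Step (c : ℕ) (D D′ : RawDiagram) : Set where
  field
    row      : ℕ
    lastPeak : LastPeak c D row
    result   : D′ ≡ map (moveCell c row) D

module ChosenRow (c : ℕ) (D : RawDiagram) where

  μ : ℤ
  μ = McMax c D

  n : ℕ
  n = suc (maxRow D)

  isMax : ℕ → Bool
  isMax t = (Mc c D t ℤ.≤ᵇ μ) ∧ (μ ℤ.≤ᵇ Mc c D t)

  isMax-complete : ∀ t → Mc c D t ≡ μ → isMax t ≡ true
  isMax-complete t e rewrite e | Equivalence.to T-≡ (ℤP.≤⇒≤ᵇ (ℤP.≤-refl {μ})) = refl

  isMax-sound : ∀ t → isMax t ≡ true → Mc c D t ≡ μ
  isMax-sound t e with ∧-true (Mc c D t ℤ.≤ᵇ μ) (μ ℤ.≤ᵇ Mc c D t) e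
  ... | ≤μ , μ≤ =
    ℤP.≤-antisym (ℤP.≤ᵇ⇒≤ (Equivalence.from T-≡ ≤μ)) (ℤP.≤ᵇ⇒≤ (Equivalence.from T-≡ μ≤))

  Mc-beyond : ∀ t → n < t → Mc c D t ≡ ℤ.+ 0
  Mc-beyond t n<t
    rewrite colGE-above-maxRow D (suc c) t (ℕP.<-trans (ℕP.n<1+n _) n<t)
          | colGE-above-maxRow D c t (ℕP.<-trans (ℕP.n<1+n _) n<t) = refl

  Mc-≤μ : ∀ t → 1 ≤ t → Mc c D t ℤ.≤ μ
  Mc-≤μ t 1≤t with ℕP.≤-<-connex t n
  ... | inj₁ t≤n = maxOver-upper (Mc c D) (ℤ.+ 0) n t 1≤t t≤n
  ... | inj₂ n<t rewrite Mc-beyond t n<t = maxOver-≥base (Mc c D) (ℤ.+ 0) n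

  module _ (μ-pos : ℤ.+ 0 ℤ.< μ) where

    r : ℕ
    r = argMaxRow c D

    attained : ∃[ t ] (1 ≤ t × t ≤ n × μ ≡ Mc c D t)
    attained with maxOver-attained (Mc c D) (ℤ.+ 0) n
    ... | inj₁ μ≡0 = ⊥-elim (ℤP.<-irrefl (sym μ≡0) μ-pos)
    ... | inj₂ witness = witness

    r-found : (1 ≤ r) × (r ≤ n) × (isMax r ≡ true)
    r-found with attained
    ... | t , 1≤t , t≤n , μ≡ = lastWhere-found isMax n t 1≤t t≤n (isMax-complete t (sym μ≡))

    Mc-r : Mc c D r ≡ μ
    Mc-r = isMax-sound r (proj₂ (proj₂ r-found))

    Mc-<μ : ∀ t → r < t → Mc c D t ℤ.< μ
    Mc-<μ t r<t with ℕP.≤-<-connex t n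
    ... | inj₁ t≤n = ℤP.≤∧≢⇒< (Mc-≤μ t (ℕP.≤-trans (s≤s z≤n) r<t)) not-max
      where
      not-max : Mc c D t ≢ μ
      not-max e = true≢false (trans (sym (isMax-complete t e)) (lastWhere-last isMax n t r<t t≤n))
    ... | inj₂ n<t rewrite Mc-beyond t n<t = μ-pos

    lastPeak : LastPeak c D r
    lastPeak = record
      { maximal = λ t 1≤t →
          diff-≤ (A t) (B t) (A r) (B r) (subst (Mc c D t ℤ.≤_) (sym Mc-r) (Mc-≤μ t 1≤t))
      ; last    = λ t r<t →
          diff-< (A t) (B t) (A r) (B r) (subst (Mc c D t ℤ.<_) (sym Mc-r) (Mc-<μ t r<t))
      }
      where
      A B : ℕ → ℕ
      A = colGE D (suc c)
      B = colGE D c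

step-of : ∀ c D D′ → eTilde c D ≡ just D′ → Step c D D′
step-of c D D′ h with McMax c D ℤ.≤ᵇ ℤ.+ 0 in μ≤ᵇ0
step-of c D D′ () | true
... | false = record
  { row      = ChosenRow.r c D μ-pos
  ; lastPeak = ChosenRow.lastPeak c D μ-pos
  ; result   = sym (just-injective h)
  }
  where
  μ-pos : ℤ.+ 0 ℤ.< McMax c D
  μ-pos = ℤP.≰⇒> (λ μ≤0 → true≢false (trans (sym (Equivalence.to T-≡ (ℤP.≤⇒≤ᵇ μ≤0))) μ≤ᵇ0))

WasIn : ℕ → ℕ → RawDiagram → Cell → Set
WasIn c r D′ x = x ≡ (suc c , r) ⊎ (x ∈ D′ × x ≢ (c , r))

module Anatomy (c : ℕ) (D D′ : RawDiagram) (uD : Unique D) (step : Step c D D′) where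

  open Step step using (lastPeak; result)

  r : ℕ
  r = Step.row step

  A B A′ B′ : ℕ → ℕ
  A  = colGE D (suc c)
  B  = colGE D c
  A′ = colGE D′ (suc c)
  B′ = colGE D′ c

  source target : Cell
  source = (suc c , r)
  target = (c , r)

  -- Since M^c(D, r+1) < M^c(D, r), row r has more cells in column c+1 than in
  -- column c; a set has at most one cell at each position, so the source
  -- cell is present and the target cell is absent.
  row-excess : count (isCell c r) D < count (isCell (suc c) r) D
  row-excess with LastPeak.last lastPeak (suc r) (ℕP.n<1+n r)
  ... | drop rewrite colGE-split D (suc c) r | colGE-split D c r =
    ℕP.+-cancelˡ-< (A (suc r) + B (suc r)) m n
      (subst₂ _<_ (regroup (A (suc r)) m (B (suc r))) (regroup′ n (A (suc r)) (B (suc r))) drop)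
    where
    m n : ℕ
    m = count (isCell c r) D
    n = count (isCell (suc c) r) D
    regroup : ∀ a m b → a + (m + b) ≡ (a + b) + m
    regroup = solve-∀
    regroup′ : ∀ m a b → (m + a) + b ≡ (a + b) + m
    regroup′ = solve-∀

  source-count≤1 : count (isCell (suc c) r) D ≤ 1
  source-count≤1 = count-≤1 (isCell (suc c) r) D source uD (isCell-sound (suc c) r)

  source-count : count (isCell (suc c) r) D ≡ 1
  source-count = ℕP.≤-antisym source-count≤1 (ℕP.≤-trans (s≤s z≤n) row-excess)

  target-count : count (isCell c r) D ≡ 0
  target-count = ℕP.n≤0⇒n≡0 (ℕP.≤-pred (ℕP.<-≤-trans row-excess source-count≤1))

  source∈D : source ∈ D
  source∈D with count-witness (isCell (suc c) r) D (ℕP.≤-reflexive (sym source-count))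
  ... | x , x∈D , is-source = subst (_∈ D) (isCell-sound (suc c) r x is-source) x∈D

  target∉D : target ∉ D
  target∉D target∈D =
    ℕP.<-irrefl (sym target-count) (count-member (isCell c r) D target target∈D (isCell-refl c r))

  A-at-row : A r ≡ suc (A (suc r))
  A-at-row = trans (colGE-split D (suc c) r) (cong (_+ A (suc r)) source-count)

  B-at-row : B r ≡ B (suc r)
  B-at-row = trans (colGE-split D c r) (cong (_+ B (suc r)) target-count)

  move : Cell → Cell
  move = moveCell c r

  move-elsewhere : ∀ x → x ≢ source → move x ≡ x
  move-elsewhere x x≢source with isCell (suc c) r x in is-source
  ... | true  = ⊥-elim (x≢source (isCell-sound (suc c) r x is-source))
  ... | false = refl

  move-source : move source ≡ target
  move-source rewrite isCell-refl (suc c) r = refl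

  move-row : ∀ x → proj₂ (move x) ≡ proj₂ x
  move-row x with isCell (suc c) r x in is-source
  ... | true  = sym (cong proj₂ (isCell-sound (suc c) r x is-source))
  ... | false = refl

  fixed-not-target : ∀ x → x ∈ D → x ≢ source → move x ≢ target
  fixed-not-target x x∈D x≢source lands =
    target∉D (subst (_∈ D) (trans (sym (move-elsewhere x x≢source)) lands) x∈D)

  move-injective : ∀ x y → x ∈ D → y ∈ D → move x ≡ move y → x ≡ y
  move-injective x y x∈D y∈D e with x ≟ᶜ source | y ≟ᶜ source
  ... | yes x≡s | yes y≡s = trans x≡s (sym y≡s)
  ... | yes x≡s | no  y≢s =
    ⊥-elim (fixed-not-target y y∈D y≢s (trans (sym e) (trans (cong move x≡s) move-source)))
  ... | no  x≢s | yes y≡s =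
    ⊥-elim (fixed-not-target x x∈D x≢s (trans e (trans (cong move y≡s) move-source)))
  ... | no  x≢s | no  y≢s = trans (sym (move-elsewhere x x≢s)) (trans e (move-elsewhere y y≢s))

  unique-after : Unique D′
  unique-after = subst Unique (sym result) (unique-map move D uD move-injective)

  -- The move stays inside row r, so every row keeps its number of cells.
  weight-after : ∀ q → weight D′ q ≡ weight D q
  weight-after q = begin
    weight D′ q                       ≡⟨ countᵇ≡count in-row D′ ⟩
    count in-row D′                   ≡⟨ cong (count in-row) result ⟩
    count in-row (map move D)         ≡⟨ count-map in-row move D ⟩
    count (λ x → in-row (move x)) D   ≡⟨ count-cong _ in-row D (λ x _ → cong (_≡ᵇ q) (move-row x)) ⟩
    count in-row D                    ≡⟨ countᵇ≡count in-row D ⟨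
    weight D q                        ∎
    where
    open ≡-Reasoning
    in-row : Cell → Bool
    in-row x = proj₂ x ≡ᵇ q

  count-after : ∀ p → count p D′ + 𝟙 (p source) ≡ count p D + 𝟙 (p target)
  count-after p = begin
    count p D′ + 𝟙 (p source)          ≡⟨ cong (λ E → count p E + 𝟙 (p source)) result ⟩
    count p (map move D) + 𝟙 (p source) ≡⟨ count-replace p move D source uD source∈D move-elsewhere ⟩
    count p D + 𝟙 (p (move source))     ≡⟨ cong (λ x → count p D + 𝟙 (p x)) move-source ⟩
    count p D + 𝟙 (p target)            ∎
    where open ≡-Reasoning

  A-after : ∀ t → A′ t + 𝟙 (t ≤ᵇ r) ≡ A t
  A-after t with count-after (inColumnFrom (suc c) t)
  ... | moved rewrite ≡ᵇ-true c c refl | ≡ᵇ-false c (suc c) (λ e → ℕP.1+n≢n (sym e))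
                    | sym (colGE≡count D′ (suc c) t) | sym (colGE≡count D (suc c) t) =
    trans moved (ℕP.+-identityʳ (A t))

  B-after : ∀ t → B′ t ≡ B t + 𝟙 (t ≤ᵇ r)
  B-after t with count-after (inColumnFrom c t)
  ... | moved rewrite ≡ᵇ-true c c refl | ≡ᵇ-false (suc c) c (ℕP.1+n≢n)
                    | sym (colGE≡count D′ c t) | sym (colGE≡count D c t) =
    trans (sym (ℕP.+-identityʳ (B′ t))) moved

  columns-below : ∀ t → t ≤ r → (A t ≡ suc (A′ t)) × (B′ t ≡ suc (B t))
  columns-below t t≤r rewrite sym (A-after t) | B-after t | ≤ᵇ-true t r t≤r =
    ℕP.+-comm (A′ t) 1 , ℕP.+-comm (B t) 1

  columns-above : ∀ t → r < t → (A′ t ≡ A t) × (B′ t ≡ B t)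
  columns-above t r<t rewrite sym (A-after t) | B-after t | ≤ᵇ-false t r r<t =
    sym (ℕP.+-identityʳ (A′ t)) , ℕP.+-identityʳ (B t)

  A′-next : A′ (suc r) ≡ A (suc r)
  A′-next = proj₁ (columns-above (suc r) (ℕP.n<1+n r))

  B′-next : B′ (suc r) ≡ B r
  B′-next = trans (proj₂ (columns-above (suc r) (ℕP.n<1+n r))) (sym B-at-row)

  -- Rows t ≤ r lost 2 in M^c and were at most M^c(D,r), so they are now
  -- strictly below M^c(D′, r+1) = M^c(D, r) − 1.
  below-next : ∀ t → 1 ≤ t → t ≤ r → RowLT c D′ t (suc r)
  below-next t 1≤t t≤r = begin-strict
    A′ t + B′ (suc r)        ≡⟨ cong (A′ t +_) B′-next ⟩
    A′ t + B r               ≤⟨ ℕP.≤-pred (subst₂ _≤_ (cong (_+ B r) (proj₁ (columns-below t t≤r)))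
                                                      (cong (_+ B t) A-at-row)
                                                      (LastPeak.maximal lastPeak t 1≤t)) ⟩
    A (suc r) + B t          <⟨ ℕP.+-monoʳ-< (A (suc r)) (ℕP.n<1+n (B t)) ⟩
    A (suc r) + suc (B t)    ≡⟨ cong₂ _+_ A′-next (proj₂ (columns-below t t≤r)) ⟨
    A′ (suc r) + B′ t        ∎
    where open ℕP.≤-Reasoning

  -- Rows t > r are unchanged and were strictly below M^c(D, r), so they are
  -- now at most M^c(D′, r+1).
  above-next : ∀ t → r < t → RowLE c D′ t (suc r)
  above-next t r<t = begin
    A′ t + B′ (suc r)        ≡⟨ cong₂ _+_ (proj₁ (columns-above t r<t)) B′-next ⟩
    A t + B r                ≤⟨ ℕP.≤-pred (subst (A t + B r <_) (cong (_+ B t) A-at-row)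
                                                 (LastPeak.last lastPeak t r<t)) ⟩
    A (suc r) + B t          ≡⟨ cong₂ _+_ A′-next (proj₂ (columns-above t r<t)) ⟨
    A′ (suc r) + B′ t        ∎
    where open ℕP.≤-Reasoning

  firstPeak-after : FirstPeak c D′ (suc r)
  firstPeak-after = record
    { maximal = λ t 1≤t → case-split t 1≤t
    ; first   = λ t 1≤t t<r+1 → below-next t 1≤t (ℕP.≤-pred t<r+1)
    }
    where
    case-split : ∀ t → 1 ≤ t → RowLE c D′ t (suc r)
    case-split t 1≤t with t ℕP.≤? r
    ... | yes t≤r = ℕP.<⇒≤ (below-next t 1≤t t≤r)
    ... | no  t≰r = above-next t (ℕP.≰⇒> t≰r)

  ∈-before : ∀ x → x ∈ D ⇔ WasIn c r D′ x
  ∈-before x = mk⇔ to from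
    where
    to : x ∈ D → WasIn c r D′ x
    to x∈D with x ≟ᶜ source
    ... | yes x≡source = inj₁ x≡source
    ... | no  x≢source =
      inj₂ ( subst (x ∈_) (sym result)
               (subst (_∈ map move D) (move-elsewhere x x≢source) (∈-map⁺ move x∈D))
           , λ x≡target → target∉D (subst (_∈ D) x≡target x∈D) )
    from : WasIn c r D′ x → x ∈ D
    from (inj₁ refl) = source∈D
    from (inj₂ (x∈D′ , x≢target)) with ∈-map⁻ move (subst (x ∈_) result x∈D′)
    ... | z , z∈D , x≡move-z with z ≟ᶜ source
    ...   | yes refl     = ⊥-elim (x≢target (trans x≡move-z move-source))
    ...   | no  z≢source = subst (_∈ D) (sym (trans x≡move-z (move-elsewhere z z≢source))) z∈D

-- Two steps of ẽ_c with the same result (as sets of cells) start from the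
-- same diagram: the results have equal column counts, hence the same first
-- peak r+1 = s+1, and then both starting diagrams are read off from it.
step-injective : ∀ c D E D′ E′ → Unique D → Unique E → Step c D D′ → Step c E E′ →
                 SameCells D′ E′ → SameCells D E
step-injective c D E D′ E′ uD uE stepD stepE same x =
  ⇔-trans (before-D.∈-before x) (⇔-trans same-before (⇔-sym (before-E.∈-before x)))
  where
  module before-D = Anatomy c D D′ uD stepD
  module before-E = Anatomy c E E′ uE stepE

  same-columns : SameColumns D′ E′
  same-columns k t =
    sameCells⇒sameCount (inColumnFrom k t) D′ E′ before-D.unique-after before-E.unique-after same

  same-row : before-D.r ≡ before-E.r
  same-row = ℕP.suc-injective (firstPeak-unique (s≤s z≤n) (s≤s z≤n)
                (firstPeak-transport same-columns before-D.firstPeak-after) before-E.firstPeak-after)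

  same-before : WasIn c before-D.r D′ x ⇔ WasIn c before-E.r E′ x
  same-before = subst (λ s → WasIn c before-D.r D′ x ⇔ WasIn c s E′ x) same-row
                      (⇔-refl ⊎-⇔ (same x ×-⇔ ⇔-refl))

record Admissible (F : Maybe RawDiagram → Maybe RawDiagram) : Set where
  field
    zero-fixed : F nothing ≡ nothing
    preserves  : ∀ D D′ → Unique D → F (just D) ≡ just D′ →
                 Unique D′ × (∀ q → weight D′ q ≡ weight D q)
    injective  : ∀ D E D′ E′ → Unique D → Unique E →
                 F (just D) ≡ just D′ → F (just E) ≡ just E′ →
                 SameCells D′ E′ → SameCells D E

id-admissible : Admissible (λ x → x)
id-admissible = record
  { zero-fixed = refl
  ; preserves  = λ D D′ uD h → subst Unique (just-injective h) uD
                             , (λ q → cong (λ E → weight E q) (sym (just-injective h)))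
  ; injective  = λ D E D′ E′ _ _ hD hE → subst₂ SameCells (sym (just-injective hD)) (sym (just-injective hE))
  }

eM-admissible : ∀ c → Admissible (eM c)
eM-admissible c = record
  { zero-fixed = refl
  ; preserves  = λ D D′ uD h → let open Anatomy c D D′ uD (step-of c D D′ h) in unique-after , weight-after
  ; injective  = λ D E D′ E′ uD uE hD hE →
                   step-injective c D E D′ E′ uD uE (step-of c D D′ hD) (step-of c E E′ hE)
  }

∘-admissible : ∀ {F G} → Admissible F → Admissible G → Admissible (λ x → F (G x))
∘-admissible {F} {G} admF admG = record
  { zero-fixed = trans (cong F (zero-fixed admG)) (zero-fixed admF)
  ; preserves  = preserves′
  ; injective  = injective′
  }
  where
  open Admissible
  nonzero : ∀ {X : Set} {D′} → F nothing ≡ just D′ → X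
  nonzero h with trans (sym (zero-fixed admF)) h
  ... | ()

  preserves′ : ∀ D D′ → Unique D → F (G (just D)) ≡ just D′ →
               Unique D′ × (∀ q → weight D′ q ≡ weight D q)
  preserves′ D D′ uD h with G (just D) in hG
  ... | nothing = nonzero h
  ... | just D₁ with preserves admG D D₁ uD hG
  ...   | uD₁ , wD₁ with preserves admF D₁ D′ uD₁ h
  ...     | uD′ , wD′ = uD′ , λ q → trans (wD′ q) (wD₁ q)

  injective′ : ∀ D E D′ E′ → Unique D → Unique E →
               F (G (just D)) ≡ just D′ → F (G (just E)) ≡ just E′ →
               SameCells D′ E′ → SameCells D E
  injective′ D E D′ E′ uD uE hD hE same with G (just D) in hGD | G (just E) in hGE
  ... | nothing | _       = nonzero hD
  ... | just _  | nothing = nonzero hE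
  ... | just D₁ | just E₁ =
    injective admG D E D₁ E₁ uD uE hGD hGE
      (injective admF D₁ E₁ D′ E′ (proj₁ (preserves admG D D₁ uD hGD))
                                  (proj₁ (preserves admG E E₁ uE hGE)) hD hE same)

applyDown-admissible : ∀ j k → Admissible (applyDown j k)
applyDown-admissible j zero    = id-admissible
applyDown-admissible j (suc k) = ∘-admissible (eM-admissible j) (applyDown-admissible (suc j) k)

blocks-admissible : ∀ k j n → Admissible (blocks k j n)
blocks-admissible k j zero    = id-admissible
blocks-admissible k j (suc n) = ∘-admissible (blocks-admissible k (suc j) n) (applyDown-admissible j k)

Rα-admissible : ∀ m (parts : List ℕ) → Admissible (λ x → foldl (λ y αᵢ → Rαi m αᵢ y) x parts)
Rα-admissible m []          = id-admissible
Rα-admissible m (αᵢ ∷ parts) =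
  ∘-admissible (Rα-admissible m parts) (blocks-admissible (m ℕ.∸ αᵢ) 1 αᵢ)

proposition5p6 : (a : List ℕ) →
    ((D D' : RawDiagram) → IsDiagram D → Rα a D ≡ just D' →
      (r : ℕ) → weight D' r ≡ weight D r)
    × ((D E D' E' : RawDiagram) → IsDiagram D → IsDiagram E →
      Rα a D ≡ just D' → Rα a E ≡ just E' →
      SameCells D' E' → SameCells D E)
proposition5p6 a =
  (λ D D′ isD h → proj₂ (preserves D D′ (proj₁ isD) h))
  , (λ D E D′ E′ isD isE → injective D E D′ E′ (proj₁ isD) (proj₁ isE))
  where open Admissible (Rα-admissible (maxPart a) (flat a))
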